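{- Let $T$ be an eligible tenacity and assume $B(w)$ is a singleton for every vertex $w$ with $t_m\le\mathrm{t}(w)\le T$. Let $\mathcal{B}_{b,t}$ and $\mathcal{B}_{b',t'}$ be blossoms with $t,t'\le T$ such that $b\in\mathcal{B}_{b',t'}$. Then $\mathcal{B}_{b,t}\subsetneq\mathcal{B}_{b',t'}$.
   Context: $G=(V,E)$ is a finite undirected graph with matching $M$; alternating paths alternate matched/unmatched edges; $l_m$ is the minimum length of an alternating path between two distinct unmatched vertices ($\infty$ if none). $\mathrm{evenlevel}(v)$ ($\mathrm{oddlevel}(v)$) is the length of a minimum even (odd) length alternating path from some unmatched vertex to $v$ ($\infty$ if none). $v$ is outer if $\mathrm{evenlevel}(v)<\mathrm{oddlevel}(v)$. Tenacity $\mathrm{t}(v)=\mathrm{evenlevel}(v)+\mathrm{oddlevel}(v)$; $t_m$ is the minimum tenacity; odd $t$ with $t_m\le t<l_m$ is eligible. For $v$ of eligible tenacity $t$ and $p$ an evenlevel$(v)$ or oddlevel$(v)$ path starting at unmatched $f$, $F(p,v)$ is the vertex of tenacity $>t$ on $p$ farthest from $f$; $B(v)$ is the set of all $F(p,v)$; if singleton, its element is $\mathrm{base}(v)$. Blossoms: for outer $b$ and odd $t\le T$ with $\mathrm{t}(b)>t$: $\mathcal{B}_{b,1}=\emptyset$, $S_{b,t}=\{v:\mathrm{t}(v)=t,\mathrm{base}(v)=b\}$, $\mathcal{B}_{b,t}=S_{b,t}\cup\bigcup_{w\in S_{b,t}\cup\{b\},\,w\text{ outer}}\mathcal{B}_{w,t-2}$.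 -}

module Defs where

open import Data.Nat using (ℕ; zero; suc; _+_; _<_; _≤_; _%_; _<?_)
open import Data.Nat.Properties using (_≟_)
open import Data.Bool using (Bool; true; false; not)
open import Data.Bool.Properties using () renaming (_≟_ to _≟B_)
open import Data.Fin using (Fin; toℕ)
open import Data.Fin.Properties using (any?; all?) renaming (_≟_ to _≟F_)
open import Data.Vec using (Vec; []; _∷_; head; last; lookup; toList)
open import Data.List.Relation.Unary.Unique.Propositional using (Unique)
open import Data.Product using (Σ; ∃; _×_; _,_; proj₁; proj₂)
open import Data.Sum using (_⊎_)
open import Data.Unit using (⊤; tt)
open import Data.Empty using (⊥)
open import Relation.Nullary using (Dec; yes; no; ¬_; does)
open import Relation.Nullary.Decidable using (_×-dec_; _⊎-dec_; ¬?; map′)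
open import Relation.Binary.PropositionalEquality using (_≡_; _≢_)

data ℕ∞ : Set where
  fin : ℕ → ℕ∞
  ∞   : ℕ∞

_+∞_ : ℕ∞ → ℕ∞ → ℕ∞
fin a +∞ fin b = fin (a + b)
_     +∞ _     = ∞

_≤∞_ : ℕ∞ → ℕ∞ → Set
fin a ≤∞ fin b = a ≤ b
fin a ≤∞ ∞     = ⊤
∞     ≤∞ fin b = ⊥
∞     ≤∞ ∞     = ⊤

_<∞_ : ℕ∞ → ℕ∞ → Set
fin a <∞ fin b = a < b
fin a <∞ ∞     = ⊤
∞     <∞ _     = ⊥

min∞ : ℕ∞ → ℕ∞ → ℕ∞
min∞ (fin a) (fin b) = fin (Data.Nat._⊓_ a b)
min∞ (fin a) ∞       = fin a
min∞ ∞       y       = y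

leastBelow : (P : ℕ → Set) → (∀ k → Dec (P k)) → ℕ → ℕ∞
leastBelow P P? bound = go 0 bound
  where
  go : ℕ → ℕ → ℕ∞
  go k zero    = ∞
  go k (suc r) with does (P? k)
  ... | true  = fin k
  ... | false = go (suc k) r

Odd : ℕ → Set
Odd k = k % 2 ≡ 1

Even : ℕ → Set
Even k = k % 2 ≡ 0

∃Vec? : ∀ {n} m (P : Vec (Fin n) m → Set) → (∀ p → Dec (P p)) → Dec (∃ P)
∃Vec? zero P P? with P? []
... | yes q = yes ([] , q)
... | no ¬q = no λ { ([] , q) → ¬q q }
∃Vec? (suc m) P P? =
  map′ (λ { (x , xs , q) → (x ∷ xs) , q })
       (λ { ((x ∷ xs) , q) → x , xs , q })
       (any? (λ x → ∃Vec? m (λ xs → P (x ∷ xs)) (λ xs → P? (x ∷ xs))))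

record MGraph (n : ℕ) : Set where
  field
    adj      : Fin n → Fin n → Bool
    adj-sym  : ∀ u v → adj u v ≡ adj v u
    adj-irr  : ∀ u → adj u u ≡ false
    mat      : Fin n → Fin n → Bool
    mat-sym  : ∀ u v → mat u v ≡ mat v u
    mat⊆adj  : ∀ u v → mat u v ≡ true → adj u v ≡ true
    mat-uniq : ∀ u v w → mat u v ≡ true → mat u w ≡ true → v ≡ w

module _ {n : ℕ} (G : MGraph n) where
  open MGraph G
  open import Data.List.Relation.Unary.Unique.DecPropositional (_≟F_ {n}) using (unique?)

  Unmatched : Fin n → Set
  Unmatched u = ∀ v → mat u v ≡ false

  Unmatched? : ∀ u → Dec (Unmatched u)
  Unmatched? u = all? (λ v → mat u v ≟B false)

  AltFrom : ∀ {k} → Bool → Vec (Fin n) (suc k) → Set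
  AltFrom b (x ∷ [])     = ⊤
  AltFrom b (x ∷ y ∷ p)  = adj x y ≡ true × mat x y ≡ b × AltFrom (not b) (y ∷ p)

  AltFrom? : ∀ {k} b (p : Vec (Fin n) (suc k)) → Dec (AltFrom b p)
  AltFrom? b (x ∷ [])    = yes tt
  AltFrom? b (x ∷ y ∷ p) = (adj x y ≟B true) ×-dec (mat x y ≟B b) ×-dec AltFrom? (not b) (y ∷ p)

  -- an alternating (simple) path with k edges, given as its k+1 vertices
  AltPath : ∀ {k} → Vec (Fin n) (suc k) → Set
  AltPath p = Unique (toList p) × (AltFrom true p ⊎ AltFrom false p)

  AltPath? : ∀ {k} (p : Vec (Fin n) (suc k)) → Dec (AltPath p)
  AltPath? p = unique? (toList p) ×-dec (AltFrom? true p ⊎-dec AltFrom? false p)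

  AltPathTo : ∀ {k} → Fin n → Vec (Fin n) (suc k) → Set
  AltPathTo v p = Unmatched (head p) × AltPath p × last p ≡ v

  AltPathTo? : ∀ {k} v (p : Vec (Fin n) (suc k)) → Dec (AltPathTo v p)
  AltPathTo? v p = Unmatched? (head p) ×-dec AltPath? p ×-dec (last p ≟F v)

  HasAltPathTo : Fin n → ℕ → Set
  HasAltPathTo v k = Σ (Vec (Fin n) (suc k)) (AltPathTo v)

  HasAltPathTo? : ∀ v k → Dec (HasAltPathTo v k)
  HasAltPathTo? v k = ∃Vec? (suc k) (AltPathTo v) (AltPathTo? v)

  -- minimum lengths; a simple path has fewer than n edges, so the
  -- search bound n (lengths 0 … n-1) loses nothing
  evenlevel : Fin n → ℕ∞
  evenlevel v = leastBelow (λ k → Even k × HasAltPathTo v k)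
                           (λ k → ((k % 2) ≟ 0) ×-dec HasAltPathTo? v k) n

  oddlevel : Fin n → ℕ∞
  oddlevel v = leastBelow (λ k → Odd k × HasAltPathTo v k)
                          (λ k → ((k % 2) ≟ 1) ×-dec HasAltPathTo? v k) n

  Outer : Fin n → Set
  Outer v = evenlevel v <∞ oddlevel v

  tenacity : Fin n → ℕ∞
  tenacity v = evenlevel v +∞ oddlevel v

  tₘ : ℕ∞
  tₘ = go n (λ i → i)
    where
    go : ∀ m → (Fin m → Fin n) → ℕ∞
    go zero    f = ∞
    go (suc m) f = min∞ (tenacity (f Fin.zero)) (go m (λ i → f (Fin.suc i)))
      where import Data.Fin as Fin

  AugPath : ℕ → Set
  AugPath k = Σ (Vec (Fin n) (suc k)) λ p →
    Unmatched (head p) × Unmatched (last p) × head p ≢ last p × AltPath p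

  AugPath? : ∀ k → Dec (AugPath k)
  AugPath? k = ∃Vec? (suc k) _ λ p →
    Unmatched? (head p) ×-dec Unmatched? (last p) ×-dec ¬? (head p ≟F last p) ×-dec AltPath? p

  lₘ : ℕ∞
  lₘ = leastBelow AugPath AugPath? n

  Eligible : ℕ → Set
  Eligible t = Odd t × tₘ ≤∞ fin t × fin t <∞ lₘ

  FarthestOn : ∀ {k} → (Fin n → Set) → Vec (Fin n) (suc k) → Fin n → Set
  FarthestOn {k} Q p b = Σ (Fin (suc k)) λ i →
    lookup p i ≡ b × Q b × (∀ j → toℕ i < toℕ j → ¬ Q (lookup p j))

  InB : Fin n → Fin n → Set
  InB v b = Σ ℕ λ t → tenacity v ≡ fin t × Eligible t ×
    Σ ℕ λ len → (evenlevel v ≡ fin len ⊎ oddlevel v ≡ fin len) ×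
    Σ (Vec (Fin n) (suc len)) λ p → AltPathTo v p ×
      FarthestOn (λ w → fin t <∞ tenacity w) p b

  SingletonB : Fin n → Set
  SingletonB v = Σ (Fin n) λ b → InB v b × (∀ c → InB v c → c ≡ b)

  IsBase : Fin n → Fin n → Set
  IsBase v b = InB v b × (∀ c → InB v c → c ≡ b)

  InS : Fin n → ℕ → Fin n → Set
  InS b t v = tenacity v ≡ fin t × IsBase v b

  InBlossom : Fin n → ℕ → Fin n → Set
  InBlossom b zero          x = ⊥
  InBlossom b (suc zero)    x = ⊥
  InBlossom b (suc (suc t)) x =
    InS b (suc (suc t)) x ⊎
    Σ (Fin n) λ w → (InS b (suc (suc t)) w ⊎ w ≡ b) × Outer w × InBlossom w t x

  IsBlossom : ℕ → Fin n → ℕ → Set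
  IsBlossom T b t = Outer b × Odd t × t ≤ T × fin t <∞ tenacity b

-- Unwinding b ∈ 𝓑_{b′,t′} gives a chain b′ = w₀, w₁, …, w_k of outer vertices with
-- w_{i+1} ∈ S_{w_i,u_i} ∪ {w_i}, ending in b ∈ S_{w_k,u}, so t(b) = u.  As t < t(b) = u and
-- both are odd, u = t + 2(j+1), and 𝓑_{b,t} ⊆ 𝓑_{b,u-2} by j times adding the step w = b;
-- then 𝓑_{b,u-2} ⊆ 𝓑_{w_k,u} because b ∈ S_{w_k,u} is outer, and so on back up the chain.
-- The inclusion is strict because b itself lies in 𝓑_{b′,t′}, while every vertex of 𝓑_{b,t}
-- has tenacity at most t < t(b).
module Submission where

open import Defs
open import Data.Nat using (ℕ; zero; suc; _+_; _*_; _/_; _%_; _<_; _≤_)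
open import Data.Nat.Properties
  using (+-comm; ≤-refl; ≤-trans; n≤1+n; <-≤-trans; <-irrefl; +-cancelˡ-<; *-cancelʳ-<; m≤n⇒∃[o]m+o≡n)
open import Data.Nat.DivMod using (m≡m%n+[m/n]*n; [m+n]%n≡m%n)
open import Data.Nat.Solver using (module +-*-Solver)
open import Data.Fin using (Fin)
open import Data.Product using (Σ; _×_; _,_)
open import Data.Sum using (inj₁; inj₂)
open import Relation.Nullary using (¬_)
open import Relation.Binary.PropositionalEquality
  using (_≡_; refl; sym; trans; cong; subst; subst₂; module ≡-Reasoning)

odd⇒≡1+[m/2]*2 : ∀ {m} → Odd m → m ≡ 1 + (m / 2) * 2
odd⇒≡1+[m/2]*2 {m} odd = trans (m≡m%n+[m/n]*n m 2) (cong (_+ (m / 2) * 2) odd)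

odd<odd⇒∃[k]≡2+k*2+ : ∀ {r u} → Odd r → Odd u → r < u → Σ ℕ λ k → u ≡ 2 + (k * 2 + r)
odd<odd⇒∃[k]≡2+k*2+ {r} {u} odd-r odd-u r<u with m≤n⇒∃[o]m+o≡n halves<
  where
  halves< : r / 2 < u / 2
  halves< = *-cancelʳ-< _ (r / 2) (u / 2) (+-cancelˡ-< 1 _ _
    (subst₂ _<_ (odd⇒≡1+[m/2]*2 odd-r) (odd⇒≡1+[m/2]*2 odd-u) r<u))
... | k , 1+r/2+k≡u/2 = k , (begin
  u                                ≡⟨ odd⇒≡1+[m/2]*2 odd-u ⟩
  1 + (u / 2) * 2                  ≡⟨ cong (λ b → 1 + b * 2) (sym 1+r/2+k≡u/2) ⟩
  1 + (1 + r / 2 + k) * 2          ≡⟨ regroup (r / 2) k ⟩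
  2 + (k * 2 + (1 + (r / 2) * 2))  ≡⟨ cong (λ m → 2 + (k * 2 + m)) (sym (odd⇒≡1+[m/2]*2 odd-r)) ⟩
  2 + (k * 2 + r)                  ∎)
  where
  open ≡-Reasoning
  open +-*-Solver
  regroup : ∀ a k → 1 + (1 + a + k) * 2 ≡ 2 + (k * 2 + (1 + a * 2))
  regroup = solve 2 (λ a k → con 1 :+ (con 1 :+ a :+ k) :* con 2
                             := con 2 :+ (k :* con 2 :+ (con 1 :+ a :* con 2))) refl

odd[2+m]⇒odd : ∀ {m} → Odd (2 + m) → Odd m
odd[2+m]⇒odd {m} odd = trans (sym ([m+n]%n≡m%n m 2)) (trans (cong (_% 2) (+-comm m 2)) odd)

≤∞-trans-fin : ∀ {a m n} → a ≤∞ fin m → m ≤ n → a ≤∞ fin n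
≤∞-trans-fin {fin a} a≤m m≤n = ≤-trans a≤m m≤n

<∞⇒≱∞ : ∀ {m a} → fin m <∞ a → ¬ (a ≤∞ fin m)
<∞⇒≱∞ {m} {fin a} m<a a≤m = <-irrefl refl (<-≤-trans m<a a≤m)

module _ {n : ℕ} (G : MGraph n) where

  InBlossom-grow : ∀ {x} → Outer G x → ∀ k {r y} →
    InBlossom G x r y → InBlossom G x (k * 2 + r) y
  InBlossom-grow outer zero    y∈𝓑 = y∈𝓑
  InBlossom-grow outer (suc k) y∈𝓑 = inj₂ (_ , inj₂ refl , outer , InBlossom-grow outer k y∈𝓑)

  InBlossom⇒tenacity≤ : ∀ {c} u {x} → InBlossom G c u x → tenacity G x ≤∞ fin u
  InBlossom⇒tenacity≤ (suc (suc u)) (inj₁ (t≡u , _)) = subst (_≤∞ fin (suc (suc u))) (sym t≡u) ≤-refl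
  InBlossom⇒tenacity≤ (suc (suc u)) (inj₂ (_ , _ , _ , x∈𝓑)) =
    ≤∞-trans-fin (InBlossom⇒tenacity≤ u x∈𝓑) (≤-trans (n≤1+n u) (n≤1+n (suc u)))

  InBlossom-⊆ : ∀ {c x r} u → Odd r → Odd u → InBlossom G c u x → Outer G x →
    fin r <∞ tenacity G x → ∀ {y} → InBlossom G x r y → InBlossom G c u y
  InBlossom-⊆ {r = r} (suc (suc u)) odd-r odd-u (inj₁ x∈S@(t≡u , _)) outer r<t y∈𝓑
    with odd<odd⇒∃[k]≡2+k*2+ odd-r odd-u (subst (fin r <∞_) t≡u r<t)
  ... | k , refl = inj₂ (_ , inj₁ x∈S , outer , InBlossom-grow outer k y∈𝓑)
  InBlossom-⊆ (suc (suc u)) odd-r odd-u (inj₂ (w , w∈S∪b , outer-w , x∈𝓑)) outer r<t y∈𝓑 =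
    inj₂ (w , w∈S∪b , outer-w , InBlossom-⊆ u odd-r (odd[2+m]⇒odd {u} odd-u) x∈𝓑 outer r<t y∈𝓑)

lemma7p4 : ∀ {n} (G : MGraph n) (T : ℕ) → Eligible G T →
    (∀ w → tₘ G ≤∞ tenacity G w → tenacity G w ≤∞ fin T → SingletonB G w) →
    ∀ (b : Fin n) (t : ℕ) (b′ : Fin n) (t′ : ℕ) →
    IsBlossom G T b t → IsBlossom G T b′ t′ → InBlossom G b′ t′ b →
    (∀ x → InBlossom G b t x → InBlossom G b′ t′ x) ×
    Σ (Fin n) (λ x → InBlossom G b′ t′ x × ¬ InBlossom G b t x)
lemma7p4 G _ _ _ b t _ t′ (outer-b , odd-t , _ , t<t[b]) (_ , odd-t′ , _ , _) b∈𝓑′ =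
  (λ _ → InBlossom-⊆ G t′ odd-t odd-t′ b∈𝓑′ outer-b t<t[b]) ,
  (b , b∈𝓑′ , λ b∈𝓑 → <∞⇒≱∞ t<t[b] (InBlossom⇒tenacity≤ G t b∈𝓑))
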